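{- Let $\mathcal{H}$ be a linear $r$-partite $r$-uniform hypergraph (with a fixed partition into parts $V_1,\dots,V_r$). Then $\mathcal{H}$ is $\mathcal{G}_r(3r-3,3)$-free if and only if it contains no rainbow 3-cycles.
   Context: A hypergraph is linear if any two distinct edges share at most one vertex. An $r$-uniform hypergraph is $r$-partite if its vertex set is partitioned into $r$ parts $V_1,\dots,V_r$ such that every edge contains exactly one vertex of each part. A cycle of length $k$ is a sequence $v_1,A_1,\dots,v_k,A_k,v_1$ with distinct vertices $v_i$, distinct edges $A_i$, $v_i,v_{i+1}\in A_i$ for $1\le i\le k-1$ and $v_k,v_1\in A_k$; it is a rainbow $k$-cycle if $v_1,\dots,v_k$ lie in pairwise different parts. An $r$-uniform hypergraph is $\mathcal{G}_r(v,e)$-free if the union of any $e$ distinct edges has at least $v+1$ vertices. -}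

module Defs where

open import Data.Nat using (ℕ; _≤_; _*_; _∸_; suc)
open import Data.Fin using (Fin)
open import Data.Fin.Subset using (Subset; _∈_; _∩_; _∪_; ∣_∣)
open import Data.Product using (_×_; ∃!; ∃-syntax)
open import Relation.Binary.PropositionalEquality using (_≡_; _≢_)

record PartiteHypergraph (r n m : ℕ) : Set where
  field
    part : Fin n → Fin r
    edge : Fin m → Subset n

open PartiteHypergraph public

-- distinct indices give distinct edges (edges form a set)
SimpleEdges : ∀ {r n m} → PartiteHypergraph r n m → Set
SimpleEdges H = ∀ a b → edge H a ≡ edge H b → a ≡ b

Uniform : ∀ {r n m} → PartiteHypergraph r n m → Set
Uniform {r} H = ∀ a → ∣ edge H a ∣ ≡ r

Partite : ∀ {r n m} → PartiteHypergraph r n m → Set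
Partite H = ∀ a i → ∃! _≡_ (λ v → (v ∈ edge H a) × (part H v ≡ i))

Linear : ∀ {r n m} → PartiteHypergraph r n m → Set
Linear H = ∀ a b → a ≢ b → ∣ edge H a ∩ edge H b ∣ ≤ 1

-- G_r(v,3)-free: the union of any 3 distinct edges has at least v+1 vertices
G3Free : ∀ {r n m} → PartiteHypergraph r n m → ℕ → Set
G3Free H v = ∀ a b c → a ≢ b → a ≢ c → b ≢ c →
  suc v ≤ ∣ edge H a ∪ edge H b ∪ edge H c ∣

RainbowCycle3 : ∀ {r n m} → PartiteHypergraph r n m →
  Fin n → Fin n → Fin n → Fin m → Fin m → Fin m → Set
RainbowCycle3 H v1 v2 v3 A1 A2 A3 =
  (v1 ≢ v2 × v1 ≢ v3 × v2 ≢ v3) ×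
  (A1 ≢ A2 × A1 ≢ A3 × A2 ≢ A3) ×
  (v1 ∈ edge H A1 × v2 ∈ edge H A1) ×
  (v2 ∈ edge H A2 × v3 ∈ edge H A2) ×
  (v3 ∈ edge H A3 × v1 ∈ edge H A3) ×
  (part H v1 ≢ part H v2 × part H v1 ≢ part H v3 × part H v2 ≢ part H v3)

HasRainbow3Cycle : ∀ {r n m} → PartiteHypergraph r n m → Set
HasRainbow3Cycle H =
  ∃[ v1 ] ∃[ v2 ] ∃[ v3 ] ∃[ A1 ] ∃[ A2 ] ∃[ A3 ]
  RainbowCycle3 H v1 v2 v3 A1 A2 A3

module Submission where

-- For three distinct edges A, B, C of an r-uniform hypergraph,
-- inclusion–exclusion gives
--     ∣A ∪ B ∪ C∣ + (∣A ∩ B∣ + ∣A ∩ C∣ + ∣B ∩ C∣) = 3r + ∣A ∩ B ∩ C∣ .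
-- By linearity each pairwise intersection has at most one vertex, so either
-- the edges form a *triangle* (pairwise intersections of size exactly one and
-- no common vertex), in which case ∣A ∪ B ∪ C∣ = 3r - 3, or the overlap sum
-- is at most 2 + ∣A ∩ B ∩ C∣, in which case ∣A ∪ B ∪ C∣ ≥ 3r - 2.
-- Hence G_r(3r-3,3)-freeness says exactly that no three edges form a
-- triangle.  Finally, a rainbow 3-cycle is the same thing as a triangle: the
-- cycle's vertices witness the pairwise intersections (linearity makes them
-- the only ones), and conversely the three meeting vertices of a triangle,
-- being pairwise distinct vertices of a common edge, lie in different parts.

open import Defs
open import Data.Nat using (ℕ; zero; suc; _+_; _*_; _∸_; _≤_; z≤n; s≤s)
open import Data.Nat.Properties hiding (_≟_)
open import Data.Nat.Tactic.RingSolver using (solve-∀)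
open import Data.Bool using (true; false)
open import Data.Fin using (Fin; _≟_)
open import Data.Fin.Subset using (Subset; _∈_; _∉_; _∩_; _∪_; _-_; ∣_∣; ⊥; Empty; Nonempty)
open import Data.Fin.Subset.Properties
  using (Empty-unique; nonempty?; ∣⊥∣≡0; x∈p∩q⁺; x∈p∩q⁻; x∈p∧x≢y⇒x∈p-y; x∈p⇒∣p-x∣<∣p∣; ∩-distribˡ-∪; ∩-assoc; ∩-comm; ∩-idem)
open import Data.Vec using ([]; _∷_)
open import Data.Product using (_×_; _,_; ∃-syntax)
open import Data.Sum using (_⊎_; inj₁; inj₂)
open import Data.Empty using (⊥-elim)
open import Relation.Nullary using (¬_; yes; no)
open import Relation.Binary.PropositionalEquality

∈⇒1≤∣p∣ : ∀ {n} {x : Fin n} {p : Subset n} → x ∈ p → 1 ≤ ∣ p ∣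
∈⇒1≤∣p∣ x∈p = ≤-trans (s≤s z≤n) (x∈p⇒∣p-x∣<∣p∣ x∈p)

∈∈⇒2≤∣p∣ : ∀ {n} {x y : Fin n} {p : Subset n} → x ∈ p → y ∈ p → x ≢ y → 2 ≤ ∣ p ∣
∈∈⇒2≤∣p∣ {x = x} {y} {p} x∈p y∈p x≢y =
  ≤-trans (s≤s (∈⇒1≤∣p∣ y∈p-x)) (x∈p⇒∣p-x∣<∣p∣ x∈p)
  where
  y∈p-x : y ∈ p - x
  y∈p-x = x∈p∧x≢y⇒x∈p-y y∈p (λ y≡x → x≢y (sym y≡x))

∣p∣≤1⇒unique : ∀ {n} {x y : Fin n} {p : Subset n} → ∣ p ∣ ≤ 1 → x ∈ p → y ∈ p → x ≡ y
∣p∣≤1⇒unique {x = x} {y} ∣p∣≤1 x∈p y∈p with x ≟ y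
... | yes x≡y = x≡y
... | no x≢y  = ⊥-elim (<⇒≱ (s≤s (s≤s z≤n)) (≤-trans (∈∈⇒2≤∣p∣ x∈p y∈p x≢y) ∣p∣≤1))

∈⇒∣p∣≡1 : ∀ {n} {x : Fin n} {p : Subset n} → ∣ p ∣ ≤ 1 → x ∈ p → ∣ p ∣ ≡ 1
∈⇒∣p∣≡1 ∣p∣≤1 x∈p = ≤-antisym ∣p∣≤1 (∈⇒1≤∣p∣ x∈p)

Empty⇒∣p∣≡0 : ∀ {n} {p : Subset n} → Empty p → ∣ p ∣ ≡ 0
Empty⇒∣p∣≡0 {n} e = trans (cong ∣_∣ (Empty-unique e)) (∣⊥∣≡0 n)

∣p∣≡0⇒∉ : ∀ {n} {x : Fin n} {p : Subset n} → ∣ p ∣ ≡ 0 → x ∉ p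
∣p∣≡0⇒∉ ∣p∣≡0 x∈p = 1+n≰n (subst (1 ≤_) ∣p∣≡0 (∈⇒1≤∣p∣ x∈p))

1≤∣p∣⇒Nonempty : ∀ {n} (p : Subset n) → 1 ≤ ∣ p ∣ → Nonempty p
1≤∣p∣⇒Nonempty p 1≤∣p∣ with nonempty? p
... | yes ne = ne
... | no e   = ⊥-elim (1+n≰n (subst (1 ≤_) (Empty⇒∣p∣≡0 e) 1≤∣p∣))

common-element : ∀ {n} (A B : Subset n) → ∣ A ∩ B ∣ ≡ 1 → ∃[ x ] (x ∈ A × x ∈ B)
common-element A B ∣A∩B∣≡1 with 1≤∣p∣⇒Nonempty (A ∩ B) (≤-reflexive (sym ∣A∩B∣≡1))
... | x , x∈A∩B = x , x∈p∩q⁻ A B x∈A∩B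

inclusion-exclusion₂ : ∀ {n} (A B : Subset n) → ∣ A ∪ B ∣ + ∣ A ∩ B ∣ ≡ ∣ A ∣ + ∣ B ∣
inclusion-exclusion₂ []            []            = refl
inclusion-exclusion₂ (true  ∷ A) (true  ∷ B) = cong suc (begin
  ∣ A ∪ B ∣ + suc ∣ A ∩ B ∣   ≡⟨ +-suc ∣ A ∪ B ∣ ∣ A ∩ B ∣ ⟩
  suc (∣ A ∪ B ∣ + ∣ A ∩ B ∣) ≡⟨ cong suc (inclusion-exclusion₂ A B) ⟩
  suc (∣ A ∣ + ∣ B ∣)         ≡⟨ +-suc ∣ A ∣ ∣ B ∣ ⟨
  ∣ A ∣ + suc ∣ B ∣           ∎)
  where open ≡-Reasoning
inclusion-exclusion₂ (true  ∷ A) (false ∷ B) = cong suc (inclusion-exclusion₂ A B)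
inclusion-exclusion₂ (false ∷ A) (true  ∷ B) =
  trans (cong suc (inclusion-exclusion₂ A B)) (sym (+-suc ∣ A ∣ ∣ B ∣))
inclusion-exclusion₂ (false ∷ A) (false ∷ B) = inclusion-exclusion₂ A B

pairwiseOverlap : ∀ {n} → Subset n → Subset n → Subset n → ℕ
pairwiseOverlap A B C = ∣ A ∩ B ∣ + ∣ A ∩ C ∣ + ∣ B ∩ C ∣

∩-pair : ∀ {n} (A B C : Subset n) → (A ∩ B) ∩ (A ∩ C) ≡ A ∩ B ∩ C
∩-pair A B C = begin
  (A ∩ B) ∩ (A ∩ C) ≡⟨ ∩-assoc A B (A ∩ C) ⟩
  A ∩ (B ∩ (A ∩ C)) ≡⟨ cong (A ∩_) (∩-assoc B A C) ⟨
  A ∩ ((B ∩ A) ∩ C) ≡⟨ cong (λ X → A ∩ (X ∩ C)) (∩-comm B A) ⟩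
  A ∩ ((A ∩ B) ∩ C) ≡⟨ cong (A ∩_) (∩-assoc A B C) ⟩
  A ∩ (A ∩ (B ∩ C)) ≡⟨ ∩-assoc A A (B ∩ C) ⟨
  (A ∩ A) ∩ (B ∩ C) ≡⟨ cong (_∩ (B ∩ C)) (∩-idem A) ⟩
  A ∩ B ∩ C         ∎
  where open ≡-Reasoning

-- Three sets, obtained from the two-set case applied to A and B ∪ C, to B
-- and C, and to A ∩ B and A ∩ C (whose union is A ∩ (B ∪ C)).
inclusion-exclusion₃ : ∀ {n} (A B C : Subset n) →
  ∣ A ∪ B ∪ C ∣ + pairwiseOverlap A B C ≡ ∣ A ∣ + ∣ B ∣ + ∣ C ∣ + ∣ A ∩ B ∩ C ∣
inclusion-exclusion₃ A B C = begin
  u + (ab + ac + bc)     ≡⟨ cong (λ k → u + (k + bc)) (sym ie-AB-AC) ⟩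
  u + (i + abc + bc)     ≡⟨ shuffle u i abc bc ⟩
  (u + i) + bc + abc     ≡⟨ cong (λ k → k + bc + abc) ie-A-BC ⟩
  a + x + bc + abc       ≡⟨ cong (_+ abc) (+-assoc a x bc) ⟩
  a + (x + bc) + abc     ≡⟨ cong (λ k → a + k + abc) (inclusion-exclusion₂ B C) ⟩
  a + (b + c) + abc      ≡⟨ cong (_+ abc) (+-assoc a b c) ⟨
  a + b + c + abc        ∎
  where
  open ≡-Reasoning
  u i x a b c ab ac bc abc : ℕ
  u = ∣ A ∪ B ∪ C ∣ ; i = ∣ A ∩ (B ∪ C) ∣ ; x = ∣ B ∪ C ∣
  a = ∣ A ∣ ; b = ∣ B ∣ ; c = ∣ C ∣
  ab = ∣ A ∩ B ∣ ; ac = ∣ A ∩ C ∣ ; bc = ∣ B ∩ C ∣ ; abc = ∣ A ∩ B ∩ C ∣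
  ie-A-BC : u + i ≡ a + x
  ie-A-BC = inclusion-exclusion₂ A (B ∪ C)
  ie-AB-AC : i + abc ≡ ab + ac
  ie-AB-AC = begin
    i + abc ≡⟨ cong (λ X → ∣ X ∣ + abc) (∩-distribˡ-∪ A B C) ⟩
    ∣ (A ∩ B) ∪ (A ∩ C) ∣ + abc
      ≡⟨ cong (λ X → ∣ (A ∩ B) ∪ (A ∩ C) ∣ + ∣ X ∣) (∩-pair A B C) ⟨
    ∣ (A ∩ B) ∪ (A ∩ C) ∣ + ∣ (A ∩ B) ∩ (A ∩ C) ∣
      ≡⟨ inclusion-exclusion₂ (A ∩ B) (A ∩ C) ⟩
    ab + ac ∎
  shuffle : ∀ u i t s → u + (i + t + s) ≡ u + i + s + t
  shuffle = solve-∀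

union-of-uniform : ∀ {n r} (A B C : Subset n) → ∣ A ∣ ≡ r → ∣ B ∣ ≡ r → ∣ C ∣ ≡ r →
  ∣ A ∪ B ∪ C ∣ + pairwiseOverlap A B C ≡ 3 * r + ∣ A ∩ B ∩ C ∣
union-of-uniform {r = r} A B C ∣A∣ ∣B∣ ∣C∣ = begin
  ∣ A ∪ B ∪ C ∣ + pairwiseOverlap A B C     ≡⟨ inclusion-exclusion₃ A B C ⟩
  ∣ A ∣ + ∣ B ∣ + ∣ C ∣ + ∣ A ∩ B ∩ C ∣     ≡⟨ cong (_+ ∣ A ∩ B ∩ C ∣) sizes ⟩
  r + r + r + ∣ A ∩ B ∩ C ∣                 ≡⟨ cong (_+ ∣ A ∩ B ∩ C ∣) (three-copies r) ⟩
  3 * r + ∣ A ∩ B ∩ C ∣                     ∎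
  where
  open ≡-Reasoning
  sizes : ∣ A ∣ + ∣ B ∣ + ∣ C ∣ ≡ r + r + r
  sizes = cong₂ _+_ (cong₂ _+_ ∣A∣ ∣B∣) ∣C∣
  three-copies : ∀ k → k + k + k ≡ 3 * k
  three-copies = solve-∀

record Triangle {n} (A B C : Subset n) : Set where
  constructor triangle
  field
    meet-AB : ∣ A ∩ B ∣ ≡ 1
    meet-AC : ∣ A ∩ C ∣ ≡ 1
    meet-BC : ∣ B ∩ C ∣ ≡ 1
    no-common : ∣ A ∩ B ∩ C ∣ ≡ 0

overlap-dichotomyℕ : ∀ {p q s} t → p ≤ 1 → q ≤ 1 → s ≤ 1 →
  (p ≡ 1 × q ≡ 1 × s ≡ 1 × t ≡ 0) ⊎ p + q + s ≤ 2 + t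
overlap-dichotomyℕ t z≤n q≤1 s≤1 = inj₂ (≤-trans (+-mono-≤ q≤1 s≤1) (m≤m+n 2 t))
overlap-dichotomyℕ t (s≤s z≤n) z≤n s≤1 = inj₂ (s≤s (≤-trans s≤1 (m≤m+n 1 t)))
overlap-dichotomyℕ t (s≤s z≤n) (s≤s z≤n) z≤n = inj₂ (m≤m+n 2 t)
overlap-dichotomyℕ zero (s≤s z≤n) (s≤s z≤n) (s≤s z≤n) = inj₁ (refl , refl , refl , refl)
overlap-dichotomyℕ (suc t) (s≤s z≤n) (s≤s z≤n) (s≤s z≤n) = inj₂ (s≤s (s≤s (s≤s z≤n)))

triangle-or-slack : ∀ {n} (A B C : Subset n) →
  ∣ A ∩ B ∣ ≤ 1 → ∣ A ∩ C ∣ ≤ 1 → ∣ B ∩ C ∣ ≤ 1 →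
  Triangle A B C ⊎ pairwiseOverlap A B C ≤ 2 + ∣ A ∩ B ∩ C ∣
triangle-or-slack A B C ab≤1 ac≤1 bc≤1
  with overlap-dichotomyℕ ∣ A ∩ B ∩ C ∣ ab≤1 ac≤1 bc≤1
... | inj₁ (ab , ac , bc , abc) = inj₁ (triangle ab ac bc abc)
... | inj₂ slack               = inj₂ slack

triangle-union-small : ∀ {n r} (A B C : Subset n) → ∣ A ∣ ≡ r → ∣ B ∣ ≡ r → ∣ C ∣ ≡ r →
  Triangle A B C → ¬ suc (3 * r ∸ 3) ≤ ∣ A ∪ B ∪ C ∣
triangle-union-small {r = r} A B C ∣A∣ ∣B∣ ∣C∣ (triangle ab ac bc abc) large =
  n≮n u (subst (λ k → suc k ≤ u) 3r∸3≡u large)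
  where
  u = ∣ A ∪ B ∪ C ∣
  u+3≡3r : u + 3 ≡ 3 * r
  u+3≡3r = begin
    u + 3                        ≡⟨ cong (u +_) (cong₂ _+_ (cong₂ _+_ ab ac) bc) ⟨
    u + pairwiseOverlap A B C            ≡⟨ union-of-uniform A B C ∣A∣ ∣B∣ ∣C∣ ⟩
    3 * r + ∣ A ∩ B ∩ C ∣        ≡⟨ cong (3 * r +_) abc ⟩
    3 * r + 0                    ≡⟨ +-identityʳ (3 * r) ⟩
    3 * r                        ∎
    where open ≡-Reasoning
  3r∸3≡u : 3 * r ∸ 3 ≡ u
  3r∸3≡u = trans (cong (_∸ 3) (sym u+3≡3r)) (m+n∸n≡m u 3)

truncated-bound : ∀ {x u} → 3 ≤ x → x ≤ u + 2 → suc (x ∸ 3) ≤ u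
truncated-bound {x} {u} 3≤x x≤u+2 = begin
  suc (x ∸ 3)   ≡⟨ +-∸-assoc 1 3≤x ⟨
  suc x ∸ 3     ≤⟨ ∸-monoˡ-≤ 3 (s≤s x≤u+2) ⟩
  suc (u + 2) ∸ 3 ≡⟨ m+n∸n≡m u 2 ⟩
  u             ∎
  where open ≤-Reasoning

slack-union-large : ∀ {n r} (A B C : Subset n) → ∣ A ∣ ≡ r → ∣ B ∣ ≡ r → ∣ C ∣ ≡ r →
  1 ≤ r → pairwiseOverlap A B C ≤ 2 + ∣ A ∩ B ∩ C ∣ → suc (3 * r ∸ 3) ≤ ∣ A ∪ B ∪ C ∣
slack-union-large {r = r} A B C ∣A∣ ∣B∣ ∣C∣ 1≤r slack =
  truncated-bound (*-monoʳ-≤ 3 1≤r) (+-cancelʳ-≤ t (3 * r) (u + 2) bound)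
  where
  open ≤-Reasoning
  u = ∣ A ∪ B ∪ C ∣
  t = ∣ A ∩ B ∩ C ∣
  bound : 3 * r + t ≤ u + 2 + t
  bound = begin
    3 * r + t          ≡⟨ union-of-uniform A B C ∣A∣ ∣B∣ ∣C∣ ⟨
    u + pairwiseOverlap A B C  ≤⟨ +-monoʳ-≤ u slack ⟩
    u + (2 + t)        ≡⟨ +-assoc u 2 t ⟨
    u + 2 + t          ∎

module _ {r n m} (H : PartiteHypergraph r n m) where

  -- Two distinct edges exist only in positive rank: in rank 0 all edges are
  -- empty and hence equal.
  positive-rank : SimpleEdges H → Uniform H → ∀ {a b} → a ≢ b → 1 ≤ r
  positive-rank simple uniform {a} {b} a≢b =
    n≢0⇒n>0 (λ r≡0 → a≢b (simple a b (trans (empty r≡0 a) (sym (empty r≡0 b)))))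
    where
    empty : r ≡ 0 → ∀ e → edge H e ≡ ⊥
    empty r≡0 e = Empty-unique (λ (x , x∈e) → ∣p∣≡0⇒∉ (trans (uniform e) r≡0) x∈e)

  distinct-parts : Partite H → ∀ {e x y} → x ∈ edge H e → y ∈ edge H e →
    x ≢ y → part H x ≢ part H y
  distinct-parts partite {e} {x} {y} x∈e y∈e x≢y same with partite e (part H x)
  ... | _ , _ , unique = x≢y (trans (sym (unique (x∈e , refl))) (unique (y∈e , sym same)))

  -- In a linear hypergraph the edges of a 3-cycle form a triangle: each
  -- cycle vertex is the unique common vertex of its two edges, so a vertex in
  -- all three edges would equal both v1 and v2.
  cycle⇒triangle : Linear H → ∀ {v1 v2 v3 A1 A2 A3} →
    RainbowCycle3 H v1 v2 v3 A1 A2 A3 → Triangle (edge H A1) (edge H A2) (edge H A3)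
  cycle⇒triangle linear {v1} {v2} {v3} {A1} {A2} {A3}
    ((v1≢v2 , _ , _) , (A1≢A2 , A1≢A3 , A2≢A3) , (v1∈A1 , v2∈A1) , (v2∈A2 , v3∈A2) , (v3∈A3 , v1∈A3) , _) =
    triangle (∈⇒∣p∣≡1 (linear _ _ A1≢A2) v2∈A1∩A2)
             (∈⇒∣p∣≡1 (linear _ _ A1≢A3) v1∈A1∩A3)
             (∈⇒∣p∣≡1 (linear _ _ A2≢A3) (x∈p∩q⁺ (v3∈A2 , v3∈A3)))
             (Empty⇒∣p∣≡0 no-common-vertex)
    where
    v2∈A1∩A2 : v2 ∈ edge H A1 ∩ edge H A2
    v2∈A1∩A2 = x∈p∩q⁺ (v2∈A1 , v2∈A2)
    v1∈A1∩A3 : v1 ∈ edge H A1 ∩ edge H A3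
    v1∈A1∩A3 = x∈p∩q⁺ (v1∈A1 , v1∈A3)
    no-common-vertex : Empty (edge H A1 ∩ edge H A2 ∩ edge H A3)
    no-common-vertex (z , z∈all) with x∈p∩q⁻ (edge H A1) _ z∈all
    ... | z∈A1 , z∈A2∩A3 with x∈p∩q⁻ (edge H A2) (edge H A3) z∈A2∩A3
    ... | z∈A2 , z∈A3 = v1≢v2 (trans v1≡z (sym v2≡z))
      where
      v1≡z : v1 ≡ z
      v1≡z = ∣p∣≤1⇒unique (linear _ _ A1≢A3) v1∈A1∩A3 (x∈p∩q⁺ (z∈A1 , z∈A3))
      v2≡z : v2 ≡ z
      v2≡z = ∣p∣≤1⇒unique (linear _ _ A1≢A2) v2∈A1∩A2 (x∈p∩q⁺ (z∈A1 , z∈A2))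

  triangle⇒cycle : Partite H → ∀ {a b c} → a ≢ b → a ≢ c → b ≢ c →
    Triangle (edge H a) (edge H b) (edge H c) → HasRainbow3Cycle H
  triangle⇒cycle partite {a} {b} {c} a≢b a≢c b≢c (triangle ab ac bc abc)
    with common-element _ _ ab | common-element _ _ ac | common-element _ _ bc
  ... | x , x∈A , x∈B | y , y∈A , y∈C | w , w∈B , w∈C =
    y , x , w , a , b , c ,
    (y≢x , y≢w , x≢w) , (a≢b , a≢c , b≢c) , (y∈A , x∈A) , (x∈B , w∈B) , (w∈C , y∈C) ,
    (distinct-parts partite y∈A x∈A y≢x ,
     distinct-parts partite y∈C w∈C y≢w ,
     distinct-parts partite x∈B w∈B x≢w)
    where
    not-in-all : ∀ {z} → z ∈ edge H a → z ∈ edge H b → ¬ z ∈ edge H c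
    not-in-all z∈A z∈B z∈C = ∣p∣≡0⇒∉ abc (x∈p∩q⁺ (z∈A , x∈p∩q⁺ (z∈B , z∈C)))
    y≢x : y ≢ x
    y≢x refl = not-in-all y∈A x∈B y∈C
    y≢w : y ≢ w
    y≢w refl = not-in-all y∈A w∈B w∈C
    x≢w : x ≢ w
    x≢w refl = not-in-all x∈A x∈B w∈C

theorem8 : ∀ {r n m} (H : PartiteHypergraph r n m) →
    SimpleEdges H → Uniform H → Partite H → Linear H →
    (G3Free H (3 * r ∸ 3) → ¬ HasRainbow3Cycle H) × (¬ HasRainbow3Cycle H → G3Free H (3 * r ∸ 3))
theorem8 H simple uniform partite linear = free⇒no-cycle , no-cycle⇒free
  where
  free⇒no-cycle : G3Free H _ → ¬ HasRainbow3Cycle H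
  free⇒no-cycle free (_ , _ , _ , A1 , A2 , A3 , cycle@(_ , (A1≢A2 , A1≢A3 , A2≢A3) , _)) =
    triangle-union-small (edge H A1) (edge H A2) (edge H A3) (uniform A1) (uniform A2) (uniform A3)
      (cycle⇒triangle H linear cycle) (free A1 A2 A3 A1≢A2 A1≢A3 A2≢A3)

  no-cycle⇒free : ¬ HasRainbow3Cycle H → G3Free H _
  no-cycle⇒free no-cycle a b c a≢b a≢c b≢c
    with triangle-or-slack (edge H a) (edge H b) (edge H c) (linear a b a≢b) (linear a c a≢c) (linear b c b≢c)
  ... | inj₁ tri   = ⊥-elim (no-cycle (triangle⇒cycle H partite a≢b a≢c b≢c tri))
  ... | inj₂ slack = slack-union-large (edge H a) (edge H b) (edge H c) (uniform a) (uniform b) (uniform c)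
                       (positive-rank H simple uniform a≢b) slack
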